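{- Let $G$ and $H$ be graphs of orders $n\ge 2$ and $n'\ge 2$, respectively. If $\gamma_{\rm sp}(G)=\frac{n}{2}$ or $\gamma_{\rm sp}(H)=\frac{n'}{2}$, then $$\gamma_{\rm sp}(G\Box H)=\frac{nn'}{2}.$$
   Context: All graphs are finite, simple and undirected. For a vertex $v$, $N(v)$ is its set of neighbours; for $D\subseteq V(G)$, $\overline{D}=V(G)\setminus D$. A set $D\subseteq V(G)$ is a super dominating set of $G$ if for every $u\in\overline{D}$ there exists $v\in D$ such that $N(v)\cap\overline{D}=\{u\}$; the super domination number $\gamma_{\rm sp}(G)$ is the minimum cardinality of a super dominating set of $G$. The Cartesian product $G\Box H$ has vertex set $V(G)\times V(H)$, with $(g,h)$ adjacent to $(g',h')$ iff either $g=g'$ and $hh'\in E(H)$, or $gg'\in E(G)$ and $h=h'$. -}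

module Defs where

open import Data.Nat using (ℕ; _*_; _≤_)
open import Data.Fin using (Fin; remQuot)
open import Data.Fin.Subset using (Subset; _∈_; _∉_; ∣_∣)
open import Data.Product using (Σ; _×_; _,_; proj₁; proj₂)
open import Relation.Binary.PropositionalEquality using (_≡_) renaming (sym to ≡-sym)
open import Data.Sum using (_⊎_; inj₁; inj₂)
open import Relation.Nullary using (¬_)
open import Function.Bundles using (_⇔_)

record Graph (n : ℕ) : Set₁ where
  field
    Adj   : Fin n → Fin n → Set
    sym   : ∀ {u v} → Adj u v → Adj v u
    irref : ∀ {v} → ¬ Adj v v
open Graph public

IsSuperDominating : ∀ {n} → Graph n → Subset n → Set
IsSuperDominating {n} G D =
  ∀ (u : Fin n) → u ∉ D →
    Σ (Fin n) λ v → v ∈ D ×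
      (∀ (w : Fin n) → ((Adj G v w × w ∉ D) ⇔ (w ≡ u)))

IsSuperDominationNumber : ∀ {n} → Graph n → ℕ → Set
IsSuperDominationNumber {n} G k =
  Σ (Subset n) (λ D → IsSuperDominating G D × ∣ D ∣ ≡ k)
  × (∀ (D : Subset n) → IsSuperDominating G D → k ≤ ∣ D ∣)

_□_ : ∀ {n m} → Graph n → Graph m → Graph (n * m)
_□_ {n} {m} G H = record
  { Adj   = λ x y → CAdj (remQuot m x) (remQuot m y)
  ; sym   = λ {x} {y} → csym (remQuot m x) (remQuot m y)
  ; irref = λ {x} → cirr (remQuot m x)
  }
  where
  CAdj : Fin n × Fin m → Fin n × Fin m → Set
  CAdj (g , h) (g' , h') = (g ≡ g' × Adj H h h') ⊎ (Adj G g g' × h ≡ h')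
  csym : ∀ p q → CAdj p q → CAdj q p
  csym (g , h) (g' , h') (inj₁ (e , a)) = inj₁ (≡-sym e , sym H a)
  csym (g , h) (g' , h') (inj₂ (a , e)) = inj₂ (sym G a , ≡-sym e)
  cirr : ∀ p → ¬ CAdj p p
  cirr (g , h) (inj₁ (_ , a)) = irref H a
  cirr (g , h) (inj₂ (a , _)) = irref G a

-- Any super dominating set D of a graph of order N has N ≤ 2∣D∣: sending each vertex outside D
-- to a vertex of D whose only neighbour outside D it is, is injective. Conversely, if D is super
-- dominating in G then D × V(H) is super dominating in G □ H, the witness of (u, h) being (v, h)
-- for a witness v of u: the neighbours of (v, h) outside its G-layer lie in D × V(H). So a super
-- dominating set of G of size n/2 gives one of G □ H of size nn'/2, optimal by the bound.
module Submission where

open import Defs hiding (sym)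
open import Data.Nat using (ℕ; zero; suc; _+_; _*_; _∸_; _≤_; _≥_; z≤n; s≤s)
open import Data.Nat.Properties
  using (+-monoʳ-≤; +-identityʳ; *-assoc; *-cancelˡ-≤; *-commutativeSemigroup; m≤n+m∸n; module ≤-Reasoning)
open import Algebra.Properties.CommutativeSemigroup *-commutativeSemigroup using (x∙yz≈y∙xz)
open import Data.Fin using (Fin; zero; suc; remQuot; quotient; remainder; combine; _↑ˡ_; _↑ʳ_)
open import Data.Fin.Properties using (remQuot-combine; combine-remQuot; splitAt-↑ʳ)
open import Data.Fin.Subset
  using (Subset; Side; inside; outside; _∈_; _∉_; _⊂_; ∣_∣; ∁; ⁅_⁆; _-_)
open import Data.Fin.Subset.Properties
  using (x∈∁p⇒x∉p; ∣∁p∣≡n∸∣p∣; nonempty?; Empty-unique; ∣⊥∣≡0; ∣⊤∣≡n; p─⊥≡p; p─q⊆p;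
         x∈p∧x≢y⇒x∈p-y; x∈p⇒p-x⊂p; x∈p⇒∣p-x∣<∣p∣)
open import Data.Fin.Subset.Induction using (Acc; acc; ⊂-wellFounded)
open import Data.Vec using ([]; _∷_; lookup; tabulate; replicate; here; there)
open import Data.Vec.Properties using ([]=⇒lookup; lookup⇒[]=; lookup∘tabulate; tabulate-cong; tabulate-∘; tabulate∘lookup; map-const)
open import Data.Product using (Σ; _×_; _,_; proj₁; proj₂)
open import Data.Sum using (_⊎_; inj₁; inj₂)
open import Data.Empty using (⊥-elim)
open import Function using (_∘_; id; const; _⇔_; mk⇔; Equivalence)
open import Relation.Nullary using (yes; no)
open import Relation.Binary.PropositionalEquality
  using (_≡_; refl; sym; trans; cong; cong₂; subst; module ≡-Reasoning)

x∉p-x : ∀ {n} (p : Subset n) (x : Fin n) → x ∉ p - x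
x∉p-x (b ∷ p) zero    ()
x∉p-x (b ∷ p) (suc x) (there x∈p-x) = x∉p-x p x x∈p-x

x∈p⇒∣p∣≡1+∣p-x∣ : ∀ {n} {p : Subset n} {x} → x ∈ p → ∣ p ∣ ≡ suc ∣ p - x ∣
x∈p⇒∣p∣≡1+∣p-x∣ {p = inside  ∷ p} here        = cong (suc ∘ ∣_∣) (sym (p─⊥≡p p))
x∈p⇒∣p∣≡1+∣p-x∣ {p = inside  ∷ p} (there x∈p) = cong suc (x∈p⇒∣p∣≡1+∣p-x∣ x∈p)
x∈p⇒∣p∣≡1+∣p-x∣ {p = outside ∷ p} (there x∈p) = x∈p⇒∣p∣≡1+∣p-x∣ x∈p

injection⇒∣p∣≤∣q∣ : ∀ {n} {p q : Subset n} (f : ∀ {x} → x ∈ p → Fin n) →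
  (∀ {x} (x∈p : x ∈ p) → f x∈p ∈ q) →
  (∀ {x y} (x∈p : x ∈ p) (y∈p : y ∈ p) → f x∈p ≡ f y∈p → x ≡ y) →
  ∣ p ∣ ≤ ∣ q ∣
injection⇒∣p∣≤∣q∣ {p = p} = go p (⊂-wellFounded p)
  where
  go : ∀ {n} (p : Subset n) {q : Subset n} → Acc _⊂_ p → (f : ∀ {x} → x ∈ p → Fin n) →
    (∀ {x} (x∈p : x ∈ p) → f x∈p ∈ q) →
    (∀ {x y} (x∈p : x ∈ p) (y∈p : y ∈ p) → f x∈p ≡ f y∈p → x ≡ y) →
    ∣ p ∣ ≤ ∣ q ∣
  go {n} p {q} (acc rec) f f∈q f-inj with nonempty? p
  ... | no  p-empty = subst (_≤ ∣ q ∣) (sym (trans (cong ∣_∣ (Empty-unique p-empty)) (∣⊥∣≡0 n))) z≤n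
  ... | yes (a , a∈p) = begin
    ∣ p ∣            ≡⟨ x∈p⇒∣p∣≡1+∣p-x∣ a∈p ⟩
    suc ∣ p - a ∣    ≤⟨ s≤s (go (p - a) (rec (x∈p⇒p-x⊂p a∈p)) (f ∘ inP) f∈q-fa f-inj′) ⟩
    suc ∣ q - f a∈p ∣ ≤⟨ x∈p⇒∣p-x∣<∣p∣ (f∈q a∈p) ⟩
    ∣ q ∣            ∎
    where
    open ≤-Reasoning
    inP : ∀ {x} → x ∈ p - a → x ∈ p
    inP = p─q⊆p p ⁅ a ⁆
    f-inj′ : ∀ {x y} (x∈ : x ∈ p - a) (y∈ : y ∈ p - a) → f (inP x∈) ≡ f (inP y∈) → x ≡ y
    f-inj′ x∈ y∈ = f-inj (inP x∈) (inP y∈)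
    f∈q-fa : ∀ {x} (x∈ : x ∈ p - a) → f (inP x∈) ∈ q - f a∈p
    f∈q-fa {x} x∈ = x∈p∧x≢y⇒x∈p-y (f∈q (inP x∈))
      (λ fx≡fa → x∉p-x p a (subst (_∈ p - a) (f-inj (inP x∈) a∈p fx≡fa) x∈))

module _ {N} (G : Graph N) where

  superDominating⇒∣∁D∣≤∣D∣ : ∀ {D} → IsSuperDominating G D → ∣ ∁ D ∣ ≤ ∣ D ∣
  superDominating⇒∣∁D∣≤∣D∣ {D} sd = injection⇒∣p∣≤∣q∣ witness witness∈D witness-injective
    where
    witness : ∀ {u} → u ∈ ∁ D → Fin N
    witness u∈∁D = proj₁ (sd _ (x∈∁p⇒x∉p u∈∁D))
    witness∈D : ∀ {u} (u∈∁D : u ∈ ∁ D) → witness u∈∁D ∈ D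
    witness∈D u∈∁D = proj₁ (proj₂ (sd _ (x∈∁p⇒x∉p u∈∁D)))
    privateNeighbour : ∀ {u} (u∈∁D : u ∈ ∁ D) w → (Adj G (witness u∈∁D) w × w ∉ D) ⇔ (w ≡ u)
    privateNeighbour u∈∁D = proj₂ (proj₂ (sd _ (x∈∁p⇒x∉p u∈∁D)))
    witness-injective : ∀ {u u'} (u∈∁D : u ∈ ∁ D) (u'∈∁D : u' ∈ ∁ D) →
      witness u∈∁D ≡ witness u'∈∁D → u ≡ u'
    witness-injective {u} u∈∁D u'∈∁D v≡v' =
      Equivalence.to (privateNeighbour u'∈∁D u)
        (subst (λ v → Adj G v u × u ∉ D) v≡v' (Equivalence.from (privateNeighbour u∈∁D u) refl))

  superDominating⇒order≤2∣D∣ : ∀ {D} → IsSuperDominating G D → N ≤ 2 * ∣ D ∣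
  superDominating⇒order≤2∣D∣ {D} sd = begin
    N                    ≤⟨ m≤n+m∸n N ∣ D ∣ ⟩
    ∣ D ∣ + (N ∸ ∣ D ∣)  ≡⟨ cong (∣ D ∣ +_) (sym (∣∁p∣≡n∸∣p∣ D)) ⟩
    ∣ D ∣ + ∣ ∁ D ∣      ≤⟨ +-monoʳ-≤ ∣ D ∣ (superDominating⇒∣∁D∣≤∣D∣ sd) ⟩
    ∣ D ∣ + ∣ D ∣        ≡⟨ cong (∣ D ∣ +_) (sym (+-identityʳ ∣ D ∣)) ⟩
    2 * ∣ D ∣            ∎
    where open ≤-Reasoning

  halfOrder-isSuperDominationNumber : ∀ {D k} → IsSuperDominating G D → ∣ D ∣ ≡ k → 2 * k ≡ N →
    IsSuperDominationNumber G k
  halfOrder-isSuperDominationNumber {D} sd ∣D∣≡k 2k≡N =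
    (D , sd , ∣D∣≡k) ,
    λ S sdS → *-cancelˡ-≤ 2 (subst (_≤ 2 * ∣ S ∣) (sym 2k≡N) (superDominating⇒order≤2∣D∣ sdS))

preimage : ∀ {N n} → (Fin N → Fin n) → Subset n → Subset N
preimage f D = tabulate (lookup D ∘ f)

∈-preimage : ∀ {N n} {f : Fin N → Fin n} {D : Subset n} {x} → (x ∈ preimage f D) ⇔ (f x ∈ D)
∈-preimage {f = f} {D} {x} = mk⇔
  (λ x∈ → lookup⇒[]= (f x) D (trans (sym (lookup∘tabulate (lookup D ∘ f) x)) ([]=⇒lookup x∈)))
  (λ fx∈ → lookup⇒[]= x (preimage f D) (trans (lookup∘tabulate (lookup D ∘ f) x) ([]=⇒lookup fx∈)))

-- K is covered by copies  layer x  of G, one through each vertex x, and a neighbour of a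
-- layer vertex off that layer lies in the same fibre of  project  (the G-layers of G □ H).
record Layering {N n} (K : Graph N) (G : Graph n) : Set where
  field
    project       : Fin N → Fin n
    layer         : Fin N → Fin n → Fin N
    project-layer : ∀ x g → project (layer x g) ≡ g
    layer-project : ∀ x → layer x (project x) ≡ x
    layer-adj     : ∀ x {g g'} → Adj G g g' → Adj K (layer x g) (layer x g')
    adj-layer     : ∀ x {g} w → Adj K (layer x g) w →
                    project w ≡ g ⊎ (Adj G g (project w) × w ≡ layer x (project w))

module _ {N n} {K : Graph N} {G : Graph n} (L : Layering K G) where
  open Layering L

  preimage-superDominating : ∀ {D} → IsSuperDominating G D → IsSuperDominating K (preimage project D)
  preimage-superDominating {D} sd x x∉S =
    layer x v , layer-v∈S , λ w → mk⇔ (privateNeighbour w) λ { refl → layer-v~x , x∉S }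
    where
    S : Subset N
    S = preimage project D
    u∉D : project x ∉ D
    u∉D = x∉S ∘ Equivalence.from ∈-preimage
    v : Fin n
    v = proj₁ (sd (project x) u∉D)
    v∈D : v ∈ D
    v∈D = proj₁ (proj₂ (sd (project x) u∉D))
    privateV : ∀ w → (Adj G v w × w ∉ D) ⇔ (w ≡ project x)
    privateV = proj₂ (proj₂ (sd (project x) u∉D))
    inS : ∀ {y g} → project y ≡ g → g ∈ D → y ∈ S
    inS πy≡g g∈D = Equivalence.from ∈-preimage (subst (_∈ D) (sym πy≡g) g∈D)
    layer-v∈S : layer x v ∈ S
    layer-v∈S = inS (project-layer x v) v∈D
    layer-v~x : Adj K (layer x v) x
    layer-v~x = subst (Adj K (layer x v)) (layer-project x)
      (layer-adj x (proj₁ (Equivalence.from (privateV (project x)) refl)))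
    privateNeighbour : ∀ w → Adj K (layer x v) w × w ∉ S → w ≡ x
    privateNeighbour w (a , w∉S) with adj-layer x w a
    ... | inj₁ πw≡v = ⊥-elim (w∉S (inS πw≡v v∈D))
    ... | inj₂ (v~πw , w≡) = begin
      w                   ≡⟨ w≡ ⟩
      layer x (project w) ≡⟨ cong (layer x) (Equivalence.to (privateV _) (v~πw , w∉S ∘ inS refl)) ⟩
      layer x (project x) ≡⟨ layer-project x ⟩
      x                   ∎
      where open ≡-Reasoning

∣tabulate∣-+ : ∀ a b (f : Fin (a + b) → Side) →
  ∣ tabulate f ∣ ≡ ∣ tabulate (f ∘ (_↑ˡ b)) ∣ + ∣ tabulate (f ∘ (a ↑ʳ_)) ∣
∣tabulate∣-+ zero    b f = refl
∣tabulate∣-+ (suc a) b f with f zero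
... | inside  = cong suc (∣tabulate∣-+ a b (f ∘ suc))
... | outside = ∣tabulate∣-+ a b (f ∘ suc)

remQuot-↑ʳ : ∀ {n} m (y : Fin (n * m)) →
  remQuot {suc n} m (m ↑ʳ y) ≡ (suc (quotient {n} m y) , remainder {n} m y)
remQuot-↑ʳ {n} m y rewrite splitAt-↑ʳ m (n * m) y = refl

∣tabulate∘remQuot∣ : ∀ n m (f : Fin (suc n) × Fin m → Side) →
  ∣ tabulate {suc n * m} (f ∘ remQuot m) ∣ ≡
  ∣ tabulate (λ j → f (zero , j)) ∣ + ∣ tabulate {n * m} (λ y → f (suc (quotient m y) , remainder {n} m y)) ∣
∣tabulate∘remQuot∣ n m f = trans (∣tabulate∣-+ m (n * m) (f ∘ remQuot m))
  (cong₂ _+_ (cong ∣_∣ (tabulate-cong (cong f ∘ remQuot-combine zero)))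
             (cong ∣_∣ (tabulate-cong (cong f ∘ remQuot-↑ʳ m))))

tabulate-const : ∀ m {A : Set} (a : A) → tabulate {m} (const a) ≡ replicate m a
tabulate-const m a = trans (tabulate-∘ (const a) id) (map-const _ a)

∣preimage-quotient∣ : ∀ n m (D : Subset n) → ∣ preimage (quotient {n} m) D ∣ ≡ ∣ D ∣ * m
∣preimage-quotient∣ zero    m []      = refl
∣preimage-quotient∣ (suc n) m (b ∷ D) =
  trans (∣tabulate∘remQuot∣ n m (lookup (b ∷ D) ∘ proj₁))
        (trans (cong₂ _+_ (cong ∣_∣ (tabulate-const m b)) (∣preimage-quotient∣ n m D)) (fibre b))
  where
  fibre : ∀ b → ∣ replicate m b ∣ + ∣ D ∣ * m ≡ ∣ b ∷ D ∣ * m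
  fibre inside  = cong (_+ ∣ D ∣ * m) (∣⊤∣≡n m)
  fibre outside = cong (_+ ∣ D ∣ * m) (∣⊥∣≡0 m)

∣preimage-remainder∣ : ∀ n m (D : Subset m) → ∣ preimage (remainder {n} m) D ∣ ≡ n * ∣ D ∣
∣preimage-remainder∣ zero    m D = refl
∣preimage-remainder∣ (suc n) m D =
  trans (∣tabulate∘remQuot∣ n m (lookup D ∘ proj₂))
        (cong₂ _+_ (cong ∣_∣ (tabulate∘lookup D)) (∣preimage-remainder∣ n m D))

module _ {n m} (G : Graph n) (H : Graph m) where

  πG : Fin (n * m) → Fin n
  πG = quotient {n} m

  πH : Fin (n * m) → Fin m
  πH = remainder {n} m

  -- Adj (G □ H) x y unfolds to  AdjPair (remQuot m x) (remQuot m y).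
  AdjPair : Fin n × Fin m → Fin n × Fin m → Set
  AdjPair (g , h) (g' , h') = (g ≡ g' × Adj H h h') ⊎ (Adj G g g' × h ≡ h')

  □-adj-combine⁺ : ∀ {g h g' h'} → AdjPair (g , h) (g' , h') → Adj (G □ H) (combine g h) (combine g' h')
  □-adj-combine⁺ {g} {h} {g'} {h'} a =
    subst (λ p → AdjPair p (remQuot m (combine g' h'))) (sym (remQuot-combine g h))
      (subst (AdjPair (g , h)) (sym (remQuot-combine g' h')) a)

  □-adj-combine⁻ : ∀ {g h} w → Adj (G □ H) (combine g h) w → AdjPair (g , h) (remQuot m w)
  □-adj-combine⁻ {g} {h} w = subst (λ p → AdjPair p (remQuot m w)) (remQuot-combine g h)

  combine-πG : ∀ {h} w → h ≡ πH w → w ≡ combine (πG w) h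
  combine-πG w h≡ = trans (sym (combine-remQuot {n} m w)) (cong (combine (πG w)) (sym h≡))

  combine-πH : ∀ {g} w → g ≡ πG w → w ≡ combine g (πH w)
  combine-πH w g≡ = trans (sym (combine-remQuot {n} m w)) (cong (λ g → combine g (πH w)) (sym g≡))

  □-G-layering : Layering (G □ H) G
  □-G-layering = record
    { project       = πG
    ; layer         = λ x g → combine g (πH x)
    ; project-layer = λ x g → cong proj₁ (remQuot-combine g (πH x))
    ; layer-project = combine-remQuot {n} m
    ; layer-adj     = λ x a → □-adj-combine⁺ (inj₂ (a , refl))
    ; adj-layer     = adj-layer
    }
    where
    adj-layer : ∀ x {g} w → Adj (G □ H) (combine g (πH x)) w →
                πG w ≡ g ⊎ (Adj G g (πG w) × w ≡ combine (πG w) (πH x))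
    adj-layer x w a with □-adj-combine⁻ w a
    ... | inj₁ (g≡ , _)   = inj₁ (sym g≡)
    ... | inj₂ (a′ , h≡) = inj₂ (a′ , combine-πG w h≡)

  □-H-layering : Layering (G □ H) H
  □-H-layering = record
    { project       = πH
    ; layer         = λ x h → combine (πG x) h
    ; project-layer = λ x h → cong proj₂ (remQuot-combine (πG x) h)
    ; layer-project = combine-remQuot {n} m
    ; layer-adj     = λ x a → □-adj-combine⁺ (inj₁ (refl , a))
    ; adj-layer     = adj-layer
    }
    where
    adj-layer : ∀ x {h} w → Adj (G □ H) (combine (πG x) h) w →
                πH w ≡ h ⊎ (Adj H h (πH w) × w ≡ combine (πG x) (πH w))
    adj-layer x w a with □-adj-combine⁻ w a
    ... | inj₁ (g≡ , a′) = inj₂ (a′ , combine-πH w g≡)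
    ... | inj₂ (_ , h≡)   = inj₁ (sym h≡)

theorem22 : ∀ {n n'} (G : Graph n) (H : Graph n') → n ≥ 2 → n' ≥ 2 →
    (Σ ℕ (λ k → IsSuperDominationNumber G k × 2 * k ≡ n)) ⊎
    (Σ ℕ (λ k → IsSuperDominationNumber H k × 2 * k ≡ n')) →
    Σ ℕ (λ k → IsSuperDominationNumber (G □ H) k × 2 * k ≡ n * n')
theorem22 {n} {n'} G H _ _ (inj₁ (k , ((D , sd , ∣D∣≡k) , _) , 2k≡n)) =
  k * n' , halfOrder-isSuperDominationNumber (G □ H) sd□ ∣D×H∣≡kn' 2kn'≡nn' , 2kn'≡nn'
  where
  sd□ : IsSuperDominating (G □ H) (preimage (quotient {n} n') D)
  sd□ = preimage-superDominating (□-G-layering G H) sd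
  ∣D×H∣≡kn' : ∣ preimage (quotient {n} n') D ∣ ≡ k * n'
  ∣D×H∣≡kn' = trans (∣preimage-quotient∣ n n' D) (cong (_* n') ∣D∣≡k)
  2kn'≡nn' : 2 * (k * n') ≡ n * n'
  2kn'≡nn' = trans (sym (*-assoc 2 k n')) (cong (_* n') 2k≡n)
theorem22 {n} {n'} G H _ _ (inj₂ (k , ((D , sd , ∣D∣≡k) , _) , 2k≡n')) =
  n * k , halfOrder-isSuperDominationNumber (G □ H) sd□ ∣G×D∣≡nk 2nk≡nn' , 2nk≡nn'
  where
  sd□ : IsSuperDominating (G □ H) (preimage (remainder {n} n') D)
  sd□ = preimage-superDominating (□-H-layering G H) sd
  ∣G×D∣≡nk : ∣ preimage (remainder {n} n') D ∣ ≡ n * k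
  ∣G×D∣≡nk = trans (∣preimage-remainder∣ n n' D) (cong (n *_) ∣D∣≡k)
  2nk≡nn' : 2 * (n * k) ≡ n * n'
  2nk≡nn' = trans (x∙yz≈y∙xz 2 n k) (cong (n *_) 2k≡n')
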